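{- For every set $A$ of finite sequences of natural numbers, if $A$ is almost-full, then there exists a stump $S$ securing $A$.
   Context: The setting is intuitionistic mathematics, in which Brouwer's Thesis on bars in $\mathcal{N}$ is accepted: for every set $B$ of finite sequences such that every $\alpha\in\mathcal{N}$ has an initial segment in $B$, there exists a stump $S$ such that every $\alpha\in\mathcal{N}$ has an initial segment in $S\cap B$. Logical constants are read constructively. Notation: $\mathcal{N}$ is the set of infinite sequences of natural numbers; finite sequences of natural numbers are identified with natural numbers via a fixed coding; $\langle\,\rangle$ is the empty sequence, $s\ast t$ concatenation, $\langle n\rangle$ the one-term sequence; $\overline{\zeta}n=\langle\zeta(0),\ldots,\zeta(n-1)\rangle$. $[\omega]^\omega=\{\zeta\in\mathcal{N}\mid\forall i[\zeta(i)<\zeta(i+1)]\}$; $[\omega]^k$ is the set of strictly increasing finite sequences of length $k$, and $[\omega]^{<\omega}=\bigcup_k[\omega]^k$; $[n]^{<n+1}$ is the set of strictly increasing finite sequences of length at most $n$ all of whose entries are $<n$. For $\zeta\in\mathcal{N}$ and a finite sequence $s$ of length $k$, $\zeta\circ s$ is the sequence of length $k$ with $(\zeta\circ s)(i)=\zeta(s(i))$; similarly, for a finite sequence $u$ of length $n$ and $s$ with all entries $<n$, $(u\circ s)(i)=u(s(i))$. A set $A$ of finite sequences is almost-full iff $\forall\zeta\in[\omega]^\omega\exists s\in[\omega]^{<\omega}[\zeta\circ s\in A]$. Stumps are the sets of finite sequences generated inductively by: $\emptyset$ is a stump; if $S_0,S_1,\ldots$ are stumps then $\{\langle\,\rangle\}\cup\bigcup_n\{\langle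 n\rangle\ast t\mid t\in S_n\}$ is a stump; nothing else is a stump. A stump $S$ secures $A$ iff $\exists m\forall\zeta\in[\omega]^\omega[\zeta(0)>m\rightarrow\exists n\exists s\in[n]^{<n+1}[\overline{\zeta}n\in S\wedge\overline{\zeta}n\circ s\in A]]$. -}

module Defs where

open import Data.Nat using (ℕ; _<_; _≤_)
open import Data.List using (List; []; _∷_; map; upTo; length)
open import Data.List.Relation.Unary.All using (All)
open import Data.List.Relation.Unary.Linked using (Linked)
open import Data.Product using (Σ; ∃; _×_)
open import Data.Empty using (⊥)
open import Data.Unit using (⊤)

-- Finite sequences of natural numbers are represented as List ℕ;
-- sets of finite sequences as predicates on List ℕ.
FinSeq : Set
FinSeq = List ℕ

Baire : Set
Baire = ℕ → ℕ

bar : Baire → ℕ → FinSeq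
bar ζ n = map ζ (upTo n)

Increasing : Baire → Set
Increasing ζ = ∀ i → ζ i < ζ (Data.Nat.suc i)

IncFin : FinSeq → Set
IncFin s = Linked _<_ s

IncFinBelow : ℕ → FinSeq → Set
IncFinBelow n s = IncFin s × (length s ≤ n) × All (_< n) s

-- ζ ∘ s  (for s with entries < n this is also  ζ̄n ∘ s)
_∘s_ : Baire → FinSeq → FinSeq
ζ ∘s s = map ζ s

-- ū ∘ s for a finite sequence u (only used when all entries of s are < length u)
lookupD : FinSeq → ℕ → ℕ
lookupD [] _ = 0
lookupD (x ∷ u) ℕ.zero = x
lookupD (x ∷ u) (ℕ.suc i) = lookupD u i

_∘f_ : FinSeq → FinSeq → FinSeq
u ∘f s = map (lookupD u) s

AlmostFull : (FinSeq → Set) → Set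
AlmostFull A = ∀ (ζ : Baire) → Increasing ζ → Σ FinSeq λ s → IncFin s × A (ζ ∘s s)

-- Stumps, generated inductively: ∅, or {⟨⟩} ∪ ⋃ₙ {⟨n⟩ * t | t ∈ Sₙ}
data Stump : Set where
  empty : Stump
  node  : (ℕ → Stump) → Stump

_∈S_ : FinSeq → Stump → Set
_ ∈S empty = ⊥
[] ∈S node f = ⊤
(n ∷ t) ∈S node f = t ∈S f n

Secures : Stump → (FinSeq → Set) → Set
Secures S A = Σ ℕ λ m → ∀ (ζ : Baire) → Increasing ζ → m < ζ 0 →
  Σ ℕ λ n → Σ FinSeq λ s → IncFinBelow n s × (bar ζ n ∈S S) × A (bar ζ n ∘f s)

-- Brouwer's Thesis on bars in 𝒩 (an axiom of the intuitionistic setting)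
BrouwersThesis : Set₁
BrouwersThesis = ∀ (B : FinSeq → Set) → (∀ (α : Baire) → Σ ℕ λ n → B (bar α n)) →
  Σ Stump λ S → ∀ (α : Baire) → Σ ℕ λ n → (bar α n ∈S S) × B (bar α n)

module Submission where

open import Defs
open import Data.Product using (Σ; _,_; _×_)
open import Data.Nat using (ℕ; zero; suc; _+_; _∸_; _<_; _≤_; z≤n; s≤s)
open import Data.Nat.Properties using (m≤m+n; m≤n+m; m+[n∸m]≡n; ≤-trans; <-≤-trans; n≤1+n)
open import Data.List using ([]; _∷_; map; applyUpTo; length)
open import Data.List.Properties using (map-upTo; map-cong-local; length-applyUpTo)
open import Data.List.Relation.Unary.All using (All; []; _∷_)
import Data.List.Relation.Unary.All as All
open import Data.Unit using (tt)
open import Function using (_∘_)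
open import Relation.Binary.PropositionalEquality using (_≡_; refl; sym; cong; subst; module ≡-Reasoning)

-- Strictly increasing sequences ζ ≥ o correspond bijectively to arbitrary sequences α
-- of gaps, via ζ 0 = o + α 0 and ζ (i+1) = ζ i + 1 + α (i+1).  Brouwer's Thesis needs
-- a bar of all of 𝒩, so it is applied in gap coordinates: the gap prefixes whose
-- increasing sequence already contains an A-pattern form a bar by almost-fullness, and
-- the stump it yields is transported back to increasing sequences.

fromGaps : ℕ → Baire → Baire
fromGaps o α zero    = o + α 0
fromGaps o α (suc i) = fromGaps (suc (o + α 0)) (α ∘ suc) i

gaps : ℕ → Baire → Baire
gaps o ζ zero    = ζ 0 ∸ o
gaps o ζ (suc i) = gaps (suc (ζ 0)) (ζ ∘ suc) i

fromGaps-increasing : ∀ o α → Increasing (fromGaps o α)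
fromGaps-increasing o α zero    = s≤s (m≤m+n _ _)
fromGaps-increasing o α (suc i) = fromGaps-increasing (suc (o + α 0)) (α ∘ suc) i

fromGaps-gaps : ∀ o ζ → o ≤ ζ 0 → Increasing ζ → ∀ i → fromGaps o (gaps o ζ) i ≡ ζ i
fromGaps-gaps o ζ o≤ζ₀ ζ↑ zero = m+[n∸m]≡n o≤ζ₀
fromGaps-gaps o ζ o≤ζ₀ ζ↑ (suc i) rewrite m+[n∸m]≡n o≤ζ₀ =
  fromGaps-gaps (suc (ζ 0)) (ζ ∘ suc) (ζ↑ 0) (ζ↑ ∘ suc) i

fromGaps-cong≤ : ∀ o α β i → (∀ j → j ≤ i → α j ≡ β j) → fromGaps o α i ≡ fromGaps o β i
fromGaps-cong≤ o α β zero    α≡β = cong (o +_) (α≡β 0 z≤n)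
fromGaps-cong≤ o α β (suc i) α≡β rewrite α≡β 0 z≤n =
  fromGaps-cong≤ (suc (o + β 0)) (α ∘ suc) (β ∘ suc) i (λ j j≤i → α≡β (suc j) (s≤s j≤i))

lookupD-applyUpTo : ∀ (α : Baire) n j → j < n → lookupD (applyUpTo α n) j ≡ α j
lookupD-applyUpTo α (suc n) zero    _         = refl
lookupD-applyUpTo α (suc n) (suc j) (s≤s j<n) = lookupD-applyUpTo (α ∘ suc) n j j<n

lookupD-bar : ∀ α n j → j < n → lookupD (bar α n) j ≡ α j
lookupD-bar α n j j<n rewrite map-upTo α n = lookupD-applyUpTo α n j j<n

length-bar : ∀ α n → length (bar α n) ≡ n
length-bar α n rewrite map-upTo α n = length-applyUpTo α n

∘f-bar : ∀ ζ n s → All (_< n) s → bar ζ n ∘f s ≡ ζ ∘s s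
∘f-bar ζ n s s<n = map-cong-local (All.map (lookupD-bar ζ n _) s<n)

fromGaps-lookupD-bar : ∀ o α n s → All (_< n) s →
  map (fromGaps o (lookupD (bar α n))) s ≡ map (fromGaps o α) s
fromGaps-lookupD-bar o α n s s<n = map-cong-local (All.map agree s<n)
  where
  agree : ∀ {i} → i < n → fromGaps o (lookupD (bar α n)) i ≡ fromGaps o α i
  agree {i} i<n = fromGaps-cong≤ o _ α i (λ j j≤i → lookupD-bar α n j (<-≤-trans (s≤s j≤i) i<n))

bounded : ∀ s → Σ ℕ λ n → length s ≤ n × All (_< n) s
bounded []      = 0 , z≤n , []
bounded (x ∷ s) with bounded s
... | n , len≤n , s<n =
  suc (x + n) , s≤s (≤-trans len≤n (m≤n+m n x)) ,
  s≤s (m≤m+n x n) ∷ All.map (λ y<n → ≤-trans y<n (≤-trans (m≤n+m n x) (n≤1+n _))) s<n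

GoodGaps : (FinSeq → Set) → FinSeq → Set
GoodGaps A u = Σ FinSeq λ s → IncFinBelow (length u) s × A (map (fromGaps 0 (lookupD u)) s)

almostFull⇒goodGaps-bar : ∀ {A} → AlmostFull A → ∀ α → Σ ℕ λ n → GoodGaps A (bar α n)
almostFull⇒goodGaps-bar {A} af α with af (fromGaps 0 α) (fromGaps-increasing 0 α)
... | s , s↑ , a with bounded s
...   | n , len≤n , s<n =
  n , s ,
  subst (λ k → IncFinBelow k s) (sym (length-bar α n)) (s↑ , len≤n , s<n) ,
  subst A (sym (fromGaps-lookupD-bar 0 α n s s<n)) a

gapStump : Stump → ℕ → Stump
gapStump empty    o = empty
gapStump (node f) o = node (λ x → gapStump (f (x ∸ o)) (suc x))

∈gapStump : ∀ S o ζ n → applyUpTo (gaps o ζ) n ∈S S → applyUpTo ζ n ∈S gapStump S o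
∈gapStump (node f) o ζ zero    _ = tt
∈gapStump (node f) o ζ (suc n) u∈S = ∈gapStump (f (ζ 0 ∸ o)) (suc (ζ 0)) (ζ ∘ suc) n u∈S

bar∈gapStump : ∀ S o ζ n → bar (gaps o ζ) n ∈S S → bar ζ n ∈S gapStump S o
bar∈gapStump S o ζ n rewrite map-upTo (gaps o ζ) n | map-upTo ζ n = ∈gapStump S o ζ n

goodGaps⇒pattern : ∀ {A} ζ → Increasing ζ → ∀ n → GoodGaps A (bar (gaps 0 ζ) n) →
  Σ FinSeq λ s → IncFinBelow n s × A (bar ζ n ∘f s)
goodGaps⇒pattern {A} ζ ζ↑ n (s , s∈ , a) with subst (λ k → IncFinBelow k s) (length-bar (gaps 0 ζ) n) s∈
... | s∈n@(_ , _ , s<n) = s , s∈n , subst A pattern≡ a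
  where
  open ≡-Reasoning
  pattern≡ : map (fromGaps 0 (lookupD (bar (gaps 0 ζ) n))) s ≡ bar ζ n ∘f s
  pattern≡ = begin
    map (fromGaps 0 (lookupD (bar (gaps 0 ζ) n))) s ≡⟨ fromGaps-lookupD-bar 0 (gaps 0 ζ) n s s<n ⟩
    map (fromGaps 0 (gaps 0 ζ)) s                   ≡⟨ map-cong-local (All.tabulate (λ {i} _ → fromGaps-gaps 0 ζ z≤n ζ↑ i)) ⟩
    ζ ∘s s                                           ≡⟨ sym (∘f-bar ζ n s s<n) ⟩
    bar ζ n ∘f s                                     ∎

gapStump-secures : ∀ {A} S → (∀ α → Σ ℕ λ n → (bar α n ∈S S) × GoodGaps A (bar α n)) →
  Secures (gapStump S 0) A
gapStump-secures {A} S barred = 0 , λ ζ ζ↑ _ →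
  let n , u∈S , good = barred (gaps 0 ζ)
      s , s∈ , a     = goodGaps⇒pattern {A} ζ ζ↑ n good
  in  n , s , s∈ , bar∈gapStump S 0 ζ n u∈S , a

corollary18p7 : BrouwersThesis → ∀ (A : FinSeq → Set) → AlmostFull A →
    Σ Stump λ S → Secures S A
corollary18p7 bt A af with bt (GoodGaps A) (almostFull⇒goodGaps-bar {A} af)
... | S , barred = gapStump S 0 , gapStump-secures {A} S barred
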